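{- Let $X$ be the Ledrappier subshift. For every $M\ge0$ there exist $n$ and $P\subset T_n$ such that $\psi_X(P)=T_n$ but $|T_n|-|\varphi(P)|\ge M$.
   Context: The Ledrappier subshift is $X=\{x\in\{0,1\}^{\mathbb{Z}^2}: x_{\vec v}+x_{\vec v+(1,0)}+x_{\vec v+(0,1)}\equiv0 \pmod 2 \text{ for all }\vec v\}$. $T=\{(0,0),(1,0),(0,1)\}$ and $T_n=\{(a,b)\in\{0,\dots,n-1\}^2:a+b\le n-1\}$. For $D,P\subset\mathbb{Z}^2$, $P$ is $D$-spanning if there is a function $f:X|_P\to X|_D$ with $x|_D=f(x|_P)$ for all $x\in X$; $\psi_X(P)$ is the maximal $D$ such that $P$ is $D$-spanning. $\varphi(P)$ is the triangle filling closure: repeatedly add the missing point of any $\vec v+T$ with $|P\cap(\vec v+T)|=2$. -}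

module Defs where

open import Data.Bool using (Bool; false; _xor_)
open import Data.Integer using (ℤ; +_; _+_; _≤_; 0ℤ; 1ℤ)
open import Data.Nat using (ℕ) renaming (_+_ to _+ℕ_; _≤_ to _≤ℕ_)
open import Data.Product using (_×_; _,_; Σ; ∃; ∃-syntax)
open import Data.List using (List; length)
open import Data.List.Membership.Propositional using (_∈_)
open import Data.List.Relation.Unary.Unique.Propositional using (Unique)
open import Function.Bundles using (_⇔_)
open import Relation.Binary.PropositionalEquality using (_≡_)

ℤ² : Set
ℤ² = ℤ × ℤ

_⊕_ : ℤ² → ℤ² → ℤ²
(a , b) ⊕ (c , d) = (a + c , b + d)

e₁ e₂ : ℤ²
e₁ = (1ℤ , 0ℤ)
e₂ = (0ℤ , 1ℤ)

Subset : Set₁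
Subset = ℤ² → Set

_⊆_ : Subset → Subset → Set
A ⊆ B = ∀ v → A v → B v

Config : Set
Config = ℤ² → Bool

InLedrappier : Config → Set
InLedrappier x = ∀ v → (x v xor x (v ⊕ e₁)) xor x (v ⊕ e₂) ≡ false

-- P is D-spanning: x|_D is a function of x|_P on X, i.e. any two points of X
-- agreeing on P agree on D.
Spanning : Subset → Subset → Set
Spanning P D = ∀ x y → InLedrappier x → InLedrappier y →
  (∀ v → P v → x v ≡ y v) → ∀ v → D v → x v ≡ y v

ψ≡ : Subset → Subset → Set₁
ψ≡ P D = Spanning P D × (∀ (D' : Subset) → Spanning P D' → D' ⊆ D)

T : ℕ → Subset
T n (a , b) = (0ℤ ≤ a) × (0ℤ ≤ b) × (a + b + 1ℤ ≤ + n)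

data φ (P : Subset) : Subset where
  base  : ∀ {v} → P v → φ P v
  fill₀ : ∀ {v} → φ P (v ⊕ e₁) → φ P (v ⊕ e₂) → φ P v
  fill₁ : ∀ {v} → φ P v → φ P (v ⊕ e₂) → φ P (v ⊕ e₁)
  fill₂ : ∀ {v} → φ P v → φ P (v ⊕ e₁) → φ P (v ⊕ e₂)

HasCard : Subset → ℕ → Set
HasCard S k = Σ (List ℤ²) λ L → Unique L × (∀ v → (v ∈ L) ⇔ S v) × (length L ≡ k)

module Submission where

-- The points of X form a group under pointwise xor, so P spans D as soon as every point
-- of X vanishing on P vanishes on D. Iterating the relation x(a,b+1) = x(a,b) + x(a+1,b)
-- gives x(a,b+2^k) = x(a,b) + x(a+2^k,b). For n = 2(m+3) take P = {(0,0),(3,0),(5,0)}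
-- ∪ {(2i,2) : i < m+2} ∪ {(2j+1,4) : j < m+1}: with k = 1 the row-2 points push
-- vanishing along the even columns of row 0 from (0,0), with k = 2 the row-4 points push it
-- along the odd columns from (1,0) and (3,0), and (1,4), (5,0) give (1,0). Once the
-- bottom row of T_n vanishes, the relation makes all of T_n vanish. Every point outside T_n
-- is separated from T_n by a reflected Pascal triangle mod 2 or its mirror image, so
-- ψ(P) = T_n. No two points of P lie in a common triangle v + T, hence φ(P) = P has
-- n points while T_n has n(n+1)/2.

open import Defs
open import Data.Nat using (ℕ; _+_; _≤_)
open import Data.Product using (_×_; Σ; ∃-syntax)

open import Algebra.Bundles using (CommutativeRing)
open import Data.Bool using (Bool; true; false; _xor_)
open import Data.Bool.Properties using (xor-assoc; xor-comm; xor-same; xor-identityʳ; xor-∧-commutativeRing)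
open import Data.Empty using (⊥; ⊥-elim)
open import Data.Integer using (ℤ; +_; -[1+_]; +≤+; 0ℤ; 1ℤ)
  renaming (_+_ to _+ℤ_; _-_ to _-ℤ_; -_ to -ℤ_)
import Data.Integer.Properties as ZP
open import Data.List using ([]; _∷_; _++_; map; upTo)
open import Data.List.Properties using (length-++; length-map; length-upTo)
open import Data.List.Membership.Propositional.Properties
  using (∈-++⁻; ∈-++⁺ˡ; ∈-++⁺ʳ; ∈-map⁺; ∈-map⁻; ∈-upTo⁺; ∈-upTo⁻)
open import Data.List.Relation.Unary.All using ([])
open import Data.List.Relation.Unary.AllPairs using ([]; _∷_)
open import Data.List.Relation.Unary.Any using (here)
import Data.List.Relation.Unary.Unique.Propositional.Properties as Unique
open import Data.Nat using (suc; zero; _<_; z<s; s<s; s<s⁻¹; _*_; _^_; _∸_; z≤n; s≤s; _≤?_)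
open import Data.Nat.Properties
  using (+-comm; +-identityʳ; +-suc; +-monoʳ-≤; *-suc; *-monoʳ-≤; *-cancelˡ-≡; suc-injective;
         ≤-trans; ≤-reflexive; <-trans; <-≤-trans; <-irrefl; <⇒≤; ≰⇒>; n≤1+n; n<1+n;
         m≤n⇒m≤1+n; m<1+n⇒m≤n; m≤n⇒m<n∨m≡n; m≤m+n; m≤n+m; m+n∸m≡n; m+[n∸m]≡n;
         m+n≤o⇒m≤o; m+n≤o⇒m≤o∸n; even≢odd; module ≤-Reasoning)
open import Data.Nat.Tactic.RingSolver using (solve-∀)
open import Data.Product using (_,_; swap; proj₁; proj₂)
open import Data.Sum using (_⊎_; inj₁; inj₂; [_,_])
import Data.Sum as Sum
open import Function using (_∘_)
open import Function.Bundles using (_⇔_; mk⇔; module Equivalence)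
open import Function.Properties.Equivalence using () renaming (sym to ⇔-sym)
open import Relation.Binary.PropositionalEquality
  using (_≡_; refl; sym; trans; cong; cong₂; subst; subst₂; module ≡-Reasoning)
open import Relation.Nullary using (yes; no; ¬_; contradiction)
open import Algebra.Properties.CommutativeSemigroup
  (CommutativeRing.+-commutativeSemigroup xor-∧-commutativeRing) using (interchange)

open Equivalence using (to; from)

xor-cancel-middle : ∀ p q r → (p xor q) xor (q xor r) ≡ p xor r
xor-cancel-middle p q r = begin
  (p xor q) xor (q xor r)   ≡⟨ xor-assoc p q (q xor r) ⟩
  p xor (q xor (q xor r))   ≡⟨ cong (p xor_) (sym (xor-assoc q q r)) ⟩
  p xor ((q xor q) xor r)   ≡⟨ cong (λ s → p xor (s xor r)) (xor-same q) ⟩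
  p xor r                   ∎
  where open ≡-Reasoning

xor-cancel-right : ∀ p q → (p xor q) xor q ≡ p
xor-cancel-right p q = begin
  (p xor q) xor q  ≡⟨ xor-assoc p q q ⟩
  p xor (q xor q)  ≡⟨ cong (p xor_) (xor-same q) ⟩
  p xor false      ≡⟨ xor-identityʳ p ⟩
  p                ∎
  where open ≡-Reasoning

xor-comm-right : ∀ p q r → (p xor q) xor r ≡ (p xor r) xor q
xor-comm-right p q r = begin
  (p xor q) xor r  ≡⟨ xor-assoc p q r ⟩
  p xor (q xor r)  ≡⟨ cong (p xor_) (xor-comm q r) ⟩
  p xor (r xor q)  ≡⟨ xor-assoc p r q ⟨
  (p xor r) xor q  ∎
  where open ≡-Reasoning

xor-vanishesʳ : ∀ {p q r} → r ≡ p xor q → r ≡ false → p ≡ false → q ≡ false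
xor-vanishesʳ {q = q} r≡p⊕q r≡0 p≡0 = trans (cong (_xor q) (sym p≡0)) (trans (sym r≡p⊕q) r≡0)

xor-vanishesˡ : ∀ {p q r} → r ≡ p xor q → r ≡ false → q ≡ false → p ≡ false
xor-vanishesˡ {p} r≡p⊕q r≡0 q≡0 =
  trans (sym (xor-identityʳ p)) (trans (cong (p xor_) (sym q≡0)) (trans (sym r≡p⊕q) r≡0))

xor≡false⇒≡ : ∀ p q → p xor q ≡ false → p ≡ q
xor≡false⇒≡ false q e = sym e
xor≡false⇒≡ true  false ()
xor≡false⇒≡ true  true  _ = refl

_⊻_ : Config → Config → Config
(x ⊻ y) v = x v xor y v

InLedrappier-⊻ : ∀ {x y} → InLedrappier x → InLedrappier y → InLedrappier (x ⊻ y)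
InLedrappier-⊻ {x} {y} hx hy v = begin
  ((x v xor y v) xor (x v₁ xor y v₁)) xor (x v₂ xor y v₂)
    ≡⟨ cong (_xor (x v₂ xor y v₂)) (interchange (x v) (y v) (x v₁) (y v₁)) ⟩
  ((x v xor x v₁) xor (y v xor y v₁)) xor (x v₂ xor y v₂)
    ≡⟨ interchange (x v xor x v₁) (y v xor y v₁) (x v₂) (y v₂) ⟩
  ((x v xor x v₁) xor x v₂) xor ((y v xor y v₁) xor y v₂)
    ≡⟨ cong₂ _xor_ (hx v) (hy v) ⟩
  false ∎
  where
    open ≡-Reasoning
    v₁ v₂ : ℤ²
    v₁ = v ⊕ e₁
    v₂ = v ⊕ e₂

pt : ℕ → ℕ → ℤ²
pt a b = (+ a , + b)

pt-⊕e₁ : ∀ a b → pt a b ⊕ e₁ ≡ pt (suc a) b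
pt-⊕e₁ a b = cong₂ _,_ (cong +_ (+-comm a 1)) (cong +_ (+-identityʳ b))

pt-⊕e₂ : ∀ a b → pt a b ⊕ e₂ ≡ pt a (suc b)
pt-⊕e₂ a b = cong₂ _,_ (cong +_ (+-identityʳ a)) (cong +_ (+-comm b 1))

ledrappier-up : ∀ {x} → InLedrappier x → ∀ a b →
                x (pt a (suc b)) ≡ x (pt a b) xor x (pt (suc a) b)
ledrappier-up {x} hx a b = sym (xor≡false⇒≡ _ _
  (subst₂ (λ u w → (x (pt a b) xor x u) xor x w ≡ false) (pt-⊕e₁ a b) (pt-⊕e₂ a b) (hx (pt a b))))

-- Iterating the rule is Frobenius in characteristic 2: (1 + X)^(2^k) = 1 + X^(2^k).
ledrappier-up-2^ : ∀ {x} → InLedrappier x → ∀ k a b →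
                   x (pt a (2 ^ k + b)) ≡ x (pt a b) xor x (pt (2 ^ k + a) b)
ledrappier-up-2^ {x} hx zero a b = ledrappier-up {x} hx a b
ledrappier-up-2^ {x} hx (suc k) a b = begin
  x (pt a (2 * h + b))
    ≡⟨ cong (λ c → x (pt a c)) (double-+ h b) ⟩
  x (pt a (h + (h + b)))
    ≡⟨ ledrappier-up-2^ {x} hx k a (h + b) ⟩
  x (pt a (h + b)) xor x (pt (h + a) (h + b))
    ≡⟨ cong₂ _xor_ (ledrappier-up-2^ {x} hx k a b) (ledrappier-up-2^ {x} hx k (h + a) b) ⟩
  (x (pt a b) xor x (pt (h + a) b)) xor (x (pt (h + a) b) xor x (pt (h + (h + a)) b))
    ≡⟨ xor-cancel-middle (x (pt a b)) (x (pt (h + a) b)) (x (pt (h + (h + a)) b)) ⟩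
  x (pt a b) xor x (pt (h + (h + a)) b)
    ≡⟨ cong (λ c → x (pt a b) xor x (pt c b)) (sym (double-+ h a)) ⟩
  x (pt a b) xor x (pt (2 * h + a) b) ∎
  where
    open ≡-Reasoning
    h : ℕ
    h = 2 ^ k
    double-+ : ∀ h c → 2 * h + c ≡ h + (h + c)
    double-+ = solve-∀

VanishesOn : Config → Subset → Set
VanishesOn z S = ∀ v → S v → z v ≡ false

Forces : Subset → Subset → Set
Forces P D = ∀ z → InLedrappier z → VanishesOn z P → VanishesOn z D

forces⇒spanning : ∀ {P D} → Forces P D → Spanning P D
forces⇒spanning forces x y hx hy agree = λ v dv →
  xor≡false⇒≡ (x v) (y v) (forces (x ⊻ y) (InLedrappier-⊻ {x} {y} hx hy) difference-vanishes v dv)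
  where
    difference-vanishes : VanishesOn (x ⊻ y) _
    difference-vanishes u pu = trans (cong (x u xor_) (sym (agree u pu))) (xor-same (x u))

Separated : Subset → ℤ² → Set
Separated S v = Σ Config λ z → InLedrappier z × VanishesOn z S × z v ≡ true

spanning⇒⊆ : ∀ {P S D} → (∀ v → S v ⊎ Separated S v) → P ⊆ S → Spanning P D → D ⊆ S
spanning⇒⊆ {P} inside-or-separated P⊆S spanning v dv with inside-or-separated v
... | inj₁ sv = sv
... | inj₂ (z , hz , z-vanishes , zv≡true) =
  contradiction (trans (spanning (λ _ → false) z (λ _ → refl) hz agrees-with-0 v dv) zv≡true) λ ()
  where
    agrees-with-0 : ∀ u → P u → false ≡ z u
    agrees-with-0 u pu = sym (z-vanishes u (P⊆S u pu))

forces-trans : ∀ {P Q R} → Forces P Q → Forces Q R → Forces P R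
forces-trans P→Q Q→R z hz = Q→R z hz ∘ P→Q z hz

T⇒pt : ∀ {n v} → T n v → ∃[ a ] ∃[ b ] v ≡ pt a b × a + b < n
T⇒pt {n} {+ a , + b} (_ , _ , +≤+ h) = a , b , refl , subst (_≤ n) (+-comm (a + b) 1) h

pt∈T : ∀ {n a b} → a + b < n → T n (pt a b)
pt∈T {n} {a} {b} lt = +≤+ z≤n , +≤+ z≤n , +≤+ (subst (_≤ n) (+-comm 1 (a + b)) lt)

BottomRow : ℕ → Subset
BottomRow n v = ∃[ a ] a < n × pt a 0 ≡ v

vanishes-upward : ∀ {z n} → InLedrappier z → VanishesOn z (BottomRow n) →
                  ∀ b a → a + b < n → z (pt a b) ≡ false
vanishes-upward {n = n} hz bottom zero a lt = bottom _ (a , subst (_< n) (+-identityʳ a) lt , refl)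
vanishes-upward {z} {n} hz bottom (suc b) a lt = begin
  z (pt a (suc b))                 ≡⟨ ledrappier-up {z} hz a b ⟩
  z (pt a b) xor z (pt (suc a) b)  ≡⟨ cong₂ _xor_ (vanishes-upward {z} hz bottom b a (<-trans (n<1+n _) lt′))
                                                  (vanishes-upward {z} hz bottom b (suc a) lt′) ⟩
  false                            ∎
  where
    open ≡-Reasoning
    lt′ : suc a + b < n
    lt′ = subst (_< n) (+-suc a b) lt

bottom-row-forces-T : ∀ n → Forces (BottomRow n) (T n)
bottom-row-forces-T n z hz z-vanishes v tv with T⇒pt tv
... | a , b , refl , lt = vanishes-upward {z} hz z-vanishes b a lt

-- choose₂ m k and choose₂⁻ m k are the binomial coefficients (m choose k) and
-- (-(m+1) choose k) modulo 2; the latter comes from running Pascal's rule backwards.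
choose₂ : ℕ → ℕ → Bool
choose₂ _       zero    = true
choose₂ zero    (suc k) = false
choose₂ (suc m) (suc k) = choose₂ m (suc k) xor choose₂ m k

choose₂⁻ : ℕ → ℕ → Bool
choose₂⁻ _       zero    = true
choose₂⁻ zero    (suc k) = true
choose₂⁻ (suc m) (suc k) = choose₂⁻ m (suc k) xor choose₂⁻ (suc m) k

binom₂ : ℤ → ℤ → Bool
binom₂ _        -[1+ _ ] = false
binom₂ (+ m)    (+ k)    = choose₂ m k
binom₂ -[1+ m ] (+ k)    = choose₂⁻ m k

binom₂-zero : ∀ n → binom₂ n 0ℤ ≡ true
binom₂-zero (+ _)    = refl
binom₂-zero -[1+ _ ] = refl

binom₂-pascal : ∀ n k → binom₂ (n +ℤ 1ℤ) k ≡ binom₂ n k xor binom₂ n (k -ℤ 1ℤ)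
binom₂-pascal n        -[1+ _ ]        = refl
binom₂-pascal n        (+ zero)        rewrite binom₂-zero (n +ℤ 1ℤ) | binom₂-zero n = refl
binom₂-pascal (+ m)    (+ suc k)       rewrite +-comm m 1 = refl
binom₂-pascal -[1+ zero ]  (+ suc zero)    = refl
binom₂-pascal -[1+ zero ]  (+ suc (suc k)) = refl
binom₂-pascal -[1+ suc m ] (+ suc k)   = sym (xor-cancel-right (choose₂⁻ m (suc k)) (choose₂⁻ (suc m) k))

choose₂-above : ∀ {d k} → d < k → choose₂ d k ≡ false
choose₂-above {zero}  {suc k} _         = refl
choose₂-above {suc d} {suc k} (s≤s d<k) rewrite choose₂-above (m≤n⇒m≤1+n d<k) | choose₂-above d<k = refl

choose₂-diagonal : ∀ d → choose₂ d d ≡ true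
choose₂-diagonal zero    = refl
choose₂-diagonal (suc d) rewrite choose₂-above (n<1+n d) | choose₂-diagonal d = refl

m-[n+1]≡m-n-1 : ∀ m n → m -ℤ (n +ℤ 1ℤ) ≡ m -ℤ n -ℤ 1ℤ
m-[n+1]≡m-n-1 m n = trans (cong (m +ℤ_) (ZP.neg-distrib-+ n 1ℤ)) (sym (ZP.+-assoc m (-ℤ n) (-ℤ 1ℤ)))

-- Row d of Pascal's triangle mod 2, reflected, with apex at (p, 0). Rows d < 0 are
-- needed too: a nonzero point of X is nonzero in every row below any of its rows.
pascal : ℤ → Config
pascal p (c , d) = binom₂ d (p -ℤ c)

pascal-ledrappier : ∀ p → InLedrappier (pascal p)
pascal-ledrappier p (c , d)
  rewrite ZP.+-identityʳ c | ZP.+-identityʳ d | m-[n+1]≡m-n-1 p c | binom₂-pascal d (p -ℤ c)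
  = xor-same (binom₂ d (p -ℤ c) xor binom₂ d (p -ℤ c -ℤ 1ℤ))

pascal-apex : ∀ p d → pascal p (p , d) ≡ true
pascal-apex p d rewrite ZP.+-inverseʳ p = binom₂-zero d

pascal-diagonal : ∀ a b → pascal (+ (a + b)) (pt a b) ≡ true
pascal-diagonal a b
  rewrite ZP.[+m]-[+n]≡m⊖n (a + b) a | ZP.⊖-≥ (m≤m+n a b) | m+n∸m≡n a b = choose₂-diagonal b

pascal-vanishes-left : ∀ k c d → pascal -[1+ k ] (+ c , d) ≡ false
pascal-vanishes-left k c d rewrite ZP.neg-minus-pos k c = refl

pascal-vanishes-below : ∀ {p c d} → c + d < p → pascal (+ p) (pt c d) ≡ false
pascal-vanishes-below {p} {c} {d} c+d<p
  rewrite ZP.[+m]-[+n]≡m⊖n p c | ZP.⊖-≥ (m+n≤o⇒m≤o c (<⇒≤ c+d<p))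
  = choose₂-above (m+n≤o⇒m≤o∸n (suc d) (subst (_≤ p) (cong suc (+-comm c d)) c+d<p))

InLedrappier-swap : ∀ {x} → InLedrappier x → InLedrappier (x ∘ swap)
InLedrappier-swap {x} hx v =
  trans (xor-comm-right (x (swap v)) (x (swap v ⊕ e₂)) (x (swap v ⊕ e₁))) (hx (swap v))

T-or-separated : ∀ n v → T n v ⊎ Separated (T n) v
T-or-separated n (+ a , + b) with suc (a + b) ≤? n
... | yes a+b<n = inj₁ (pt∈T a+b<n)
... | no  a+b≮n = inj₂ (pascal (+ (a + b)) , pascal-ledrappier (+ (a + b)) , vanishes , pascal-diagonal a b)
  where
    vanishes : VanishesOn (pascal (+ (a + b))) (T n)
    vanishes v tv with T⇒pt tv
    ... | c , d , refl , c+d<n = pascal-vanishes-below {c = c} {d} (<-≤-trans c+d<n (m<1+n⇒m≤n (≰⇒> a+b≮n)))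
T-or-separated n (-[1+ k ] , d) =
  inj₂ (pascal -[1+ k ] , pascal-ledrappier -[1+ k ] , vanishes , pascal-apex -[1+ k ] d)
  where
    vanishes : VanishesOn (pascal -[1+ k ]) (T n)
    vanishes v tv with T⇒pt tv
    ... | c , d , refl , _ = pascal-vanishes-left k c (+ d)
T-or-separated n (+ a , -[1+ k ]) =
  inj₂ (pascal -[1+ k ] ∘ swap , InLedrappier-swap {pascal -[1+ k ]} (pascal-ledrappier -[1+ k ]) , vanishes , pascal-apex -[1+ k ] (+ a))
  where
    vanishes : VanishesOn (pascal -[1+ k ] ∘ swap) (T n)
    vanishes v tv with T⇒pt tv
    ... | c , d , refl , _ = pascal-vanishes-left k d (+ c)

φ-⊆ : ∀ {P} → (∀ {u w} → P u → P w → proj₂ w ≡ proj₂ u +ℤ 1ℤ → ⊥) →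
      (∀ {v} → P v → P (v ⊕ e₁) → ⊥) → φ P ⊆ P
φ-⊆ rows-apart not-adjacent v (base pv) = pv
φ-⊆ rows-apart not-adjacent v (fill₀ {v = c , d} h₁ h₂) =
  ⊥-elim (rows-apart (φ-⊆ rows-apart not-adjacent _ h₁) (φ-⊆ rows-apart not-adjacent _ h₂)
                     (cong (_+ℤ 1ℤ) (sym (ZP.+-identityʳ d))))
φ-⊆ rows-apart not-adjacent v (fill₁ h₀ h₂) =
  ⊥-elim (rows-apart (φ-⊆ rows-apart not-adjacent _ h₀) (φ-⊆ rows-apart not-adjacent _ h₂) refl)
φ-⊆ rows-apart not-adjacent v (fill₂ h₀ h₁) =
  ⊥-elim (not-adjacent (φ-⊆ rows-apart not-adjacent _ h₀) (φ-⊆ rows-apart not-adjacent _ h₁))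

_∪_ : Subset → Subset → Subset
(A ∪ B) v = A v ⊎ B v

｛_｝ : ℤ² → Subset
｛ u ｝ v = u ≡ v

Image : (ℕ → ℤ²) → ℕ → Subset
Image f k v = ∃[ i ] i < k × f i ≡ v

HasCard-⇔ : ∀ {A B k} → (∀ v → A v ⇔ B v) → HasCard A k → HasCard B k
HasCard-⇔ A⇔B (L , unique , mem , len) =
  L , unique , (λ v → mk⇔ (to (A⇔B v) ∘ to (mem v)) (from (mem v) ∘ from (A⇔B v))) , len

HasCard-empty : ∀ {A} → (∀ v → ¬ A v) → HasCard A 0
HasCard-empty empty = [] , [] , (λ v → mk⇔ (λ ()) (⊥-elim ∘ empty v)) , refl

HasCard-singleton : ∀ u → HasCard ｛ u ｝ 1
HasCard-singleton u = u ∷ [] , [] ∷ [] , (λ v → mk⇔ (λ { (here refl) → refl }) (λ { refl → here refl })) , refl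

HasCard-∪ : ∀ {A B a b} → HasCard A a → HasCard B b → (∀ {v} → A v → B v → ⊥) → HasCard (A ∪ B) (a + b)
HasCard-∪ {A} {B} (L , uL , memL , refl) (K , uK , memK , refl) disjoint =
  L ++ K , Unique.++⁺ uL uK (λ (v∈L , v∈K) → disjoint (to (memL _) v∈L) (to (memK _) v∈K)) ,
  (λ v → mk⇔ (Sum.map (to (memL v)) (to (memK v)) ∘ ∈-++⁻ L)
             [ ∈-++⁺ˡ ∘ from (memL v) , ∈-++⁺ʳ L ∘ from (memK v) ]) ,
  length-++ L

HasCard-image : ∀ f → (∀ {i j} → f i ≡ f j → i ≡ j) → ∀ k → HasCard (Image f k) k
HasCard-image f injective k =
  map f (upTo k) , Unique.map⁺ injective (Unique.upTo⁺ k) ,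
  (λ v → mk⇔ (λ v∈ → let i , i∈ , v≡fi = ∈-map⁻ f v∈ in i , ∈-upTo⁻ i∈ , sym v≡fi)
             (λ { (i , i<k , refl) → ∈-map⁺ f (∈-upTo⁺ i<k) })) ,
  trans (length-map f (upTo k)) (length-upTo k)

triangular : ℕ → ℕ
triangular zero    = 0
triangular (suc n) = suc n + triangular n

n≤triangular : ∀ n → n ≤ triangular n
n≤triangular zero    = z≤n
n≤triangular (suc n) = m≤m+n (suc n) (triangular n)

m<n⇒m+n≤triangular : ∀ {m n} → m < n → m + n ≤ triangular n
m<n⇒m+n≤triangular {m} {suc n} (s≤s m≤n) = begin
  m + suc n          ≡⟨ +-comm m (suc n) ⟩
  suc n + m          ≤⟨ +-monoʳ-≤ (suc n) (≤-trans m≤n (n≤triangular n)) ⟩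
  suc n + triangular n ∎
  where open ≤-Reasoning

diagonal : ℕ → ℕ → ℤ²
diagonal k a = pt a (k ∸ a)

T-suc⇔ : ∀ k v → T (suc k) v ⇔ (Image (diagonal k) (suc k) ∪ T k) v
T-suc⇔ k v = mk⇔ split join
  where
    split : T (suc k) v → (Image (diagonal k) (suc k) ∪ T k) v
    split tv with T⇒pt tv
    ... | a , b , refl , s≤s a+b≤k with m≤n⇒m<n∨m≡n a+b≤k
    ...   | inj₁ a+b<k = inj₂ (pt∈T a+b<k)
    ...   | inj₂ refl  = inj₁ (a , s≤s (m≤m+n a b) , cong (pt a) (m+n∸m≡n a b))
    join : (Image (diagonal k) (suc k) ∪ T k) v → T (suc k) v
    join (inj₁ (a , s≤s a≤k , refl)) = pt∈T (s≤s (≤-reflexive (m+[n∸m]≡n a≤k)))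
    join (inj₂ (p , q , r)) = p , q , ZP.≤-trans r (+≤+ (n≤1+n k))

HasCard-T : ∀ n → HasCard (T n) (triangular n)
HasCard-T zero = HasCard-empty T-zero-empty
  where
    T-zero-empty : ∀ v → ¬ T 0 v
    T-zero-empty v tv with T⇒pt tv
    ... | _ , _ , _ , ()
HasCard-T (suc k) =
  HasCard-⇔ (λ v → ⇔-sym (T-suc⇔ k v))
    (HasCard-∪ (HasCard-image (diagonal k) (λ e → ZP.+-injective (cong proj₁ e)) (suc k)) (HasCard-T k) disjoint)
  where
    disjoint : ∀ {v} → Image (diagonal k) (suc k) v → T k v → ⊥
    disjoint (a , s≤s a≤k , refl) (_ , _ , +≤+ a+[k∸a]+1≤k) =
      <-irrefl (m+[n∸m]≡n a≤k) (subst (_≤ k) (+-comm _ 1) a+[k∸a]+1≤k)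

pairs-cover : ∀ {Q : ℕ → Set} k → (∀ j → j < k → Q (2 * j) × Q (suc (2 * j))) → ∀ a → a < 2 * k → Q a
pairs-cover (suc k) pair zero          _  = proj₁ (pair 0 z<s)
pairs-cover (suc k) pair (suc zero)    _  = proj₂ (pair 0 z<s)
pairs-cover {Q} (suc k) pair (suc (suc a)) lt =
  pairs-cover {Q ∘ suc ∘ suc} k shifted a (s<s⁻¹ (s<s⁻¹ (subst (suc (suc a) <_) (*-suc 2 k) lt)))
  where
    shifted : ∀ j → j < k → Q (suc (suc (2 * j))) × Q (suc (suc (suc (2 * j))))
    shifted j j<k = subst (λ c → Q c × Q (suc c)) (*-suc 2 j) (pair (suc j) (s<s j<k))

data Seed (m : ℕ) : ℕ → ℕ → Set where
  seed₀ : Seed m 0 0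
  seed₃ : Seed m 3 0
  seed₅ : Seed m 5 0
  even₂ : ∀ {a} i → i < 2 + m → a ≡ 2 * i → Seed m a 2
  odd₄  : ∀ {a} j → j < 1 + m → a ≡ suc (2 * j) → Seed m a 4

seeds : ℕ → Subset
seeds m v = ∃[ a ] ∃[ b ] v ≡ pt a b × Seed m a b

seed<2[3+m] : ∀ {m a b} → Seed m a b → a + b < 2 * (3 + m)
seed<2[3+m] seed₀ = s≤s z≤n
seed<2[3+m] {m} seed₃ = ≤-trans (s≤s (s≤s (s≤s (s≤s z≤n)))) (*-monoʳ-≤ 2 (m≤m+n 3 m))
seed<2[3+m] {m} seed₅ = *-monoʳ-≤ 2 (m≤m+n 3 m)
seed<2[3+m] {m} (even₂ i i<2+m refl) = begin
  suc (2 * i + 2)  ≤⟨ n≤1+n _ ⟩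
  2 + (2 * i + 2)  ≡⟨ eq i ⟩
  2 * (2 + i)      ≤⟨ *-monoʳ-≤ 2 (s≤s i<2+m) ⟩
  2 * (3 + m)      ∎
  where
    open ≤-Reasoning
    eq : ∀ i → 2 + (2 * i + 2) ≡ 2 * (2 + i)
    eq = solve-∀
seed<2[3+m] {m} (odd₄ j (s≤s j≤m) refl) = begin
  suc (suc (2 * j) + 4)  ≡⟨ eq j ⟩
  2 * (3 + j)            ≤⟨ *-monoʳ-≤ 2 (+-monoʳ-≤ 3 j≤m) ⟩
  2 * (3 + m)            ∎
  where
    open ≤-Reasoning
    eq : ∀ j → suc (suc (2 * j) + 4) ≡ 2 * (3 + j)
    eq = solve-∀

seeds⊆T : ∀ m → seeds m ⊆ T (2 * (3 + m))
seeds⊆T m v (a , b , refl , s) = pt∈T (seed<2[3+m] s)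

seeds-force-bottom-row : ∀ m → Forces (seeds m) (BottomRow (2 * (3 + m)))
seeds-force-bottom-row m z hz z-vanishes _ (a , a<n , refl) =
  pairs-cover {λ a → z (pt a 0) ≡ false} (3 + m) go a a<n
  where
    at : ∀ {a b} → Seed m a b → z (pt a b) ≡ false
    at s = z-vanishes _ (_ , _ , refl , s)
    go : ∀ i → i < 3 + m → z (pt (2 * i) 0) ≡ false × z (pt (suc (2 * i)) 0) ≡ false
    go zero _ =
      at seed₀ ,
      xor-vanishesˡ (ledrappier-up-2^ {z} hz 2 1 0) (at (odd₄ 0 z<s refl)) (at seed₅)
    go (suc zero) _ =
      xor-vanishesʳ (ledrappier-up-2^ {z} hz 1 0 0) (at (even₂ 0 z<s refl)) (at seed₀) ,
      at seed₃
    go (suc (suc i)) (s≤s (s≤s i<1+m)) =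
      even (proj₁ (go (suc i) (s≤s (m≤n⇒m≤1+n i<1+m)))) ,
      odd (proj₂ (go i (m≤n⇒m≤1+n (m≤n⇒m≤1+n i<1+m))))
      where
        even : z (pt (2 * suc i) 0) ≡ false → z (pt (2 * (2 + i)) 0) ≡ false
        even previous = subst (λ c → z (pt c 0) ≡ false) (sym (*-suc 2 (suc i)))
          (xor-vanishesʳ (ledrappier-up-2^ {z} hz 1 (2 * suc i) 0) (at (even₂ (suc i) (s≤s i<1+m) refl)) previous)
        [2i+1]+4≡2[i+2]+1 : ∀ i → 4 + suc (2 * i) ≡ suc (2 * (2 + i))
        [2i+1]+4≡2[i+2]+1 = solve-∀
        odd : z (pt (suc (2 * i)) 0) ≡ false → z (pt (suc (2 * (2 + i))) 0) ≡ false
        odd previous = subst (λ c → z (pt c 0) ≡ false) ([2i+1]+4≡2[i+2]+1 i)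
          (xor-vanishesʳ (ledrappier-up-2^ {z} hz 2 (suc (2 * i)) 0) (at (odd₄ i i<1+m refl)) previous)

seed-row-even : ∀ {m a b} → Seed m a b → ∃[ r ] b ≡ 2 * r
seed-row-even seed₀         = 0 , refl
seed-row-even seed₃         = 0 , refl
seed-row-even seed₅         = 0 , refl
seed-row-even (even₂ _ _ _) = 1 , refl
seed-row-even (odd₄ _ _ _)  = 2 , refl

seeds-not-adjacent : ∀ {m a b} → Seed m a b → Seed m (suc a) b → ⊥
seeds-not-adjacent seed₀ ()
seeds-not-adjacent seed₃ ()
seeds-not-adjacent seed₅ ()
seeds-not-adjacent (even₂ i _ refl) (even₂ j _ e) = even≢odd j i (sym e)
seeds-not-adjacent (odd₄ i _ refl)  (odd₄ j _ e)  = even≢odd j i (sym (suc-injective e))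

pt-injective : ∀ {a b c d} → pt a b ≡ pt c d → a ≡ c × b ≡ d
pt-injective refl = refl , refl

φ-seeds : ∀ m → φ (seeds m) ⊆ seeds m
φ-seeds m = φ-⊆ rows-apart not-adjacent
  where
    rows-apart : ∀ {u w} → seeds m u → seeds m w → proj₂ w ≡ proj₂ u +ℤ 1ℤ → ⊥
    rows-apart (a , b , refl , s) (a′ , b′ , refl , s′) e
      with seed-row-even s | seed-row-even s′
    ... | r , refl | r′ , refl = even≢odd r′ r (trans (ZP.+-injective e) (+-comm (2 * r) 1))
    not-adjacent : ∀ {v} → seeds m v → seeds m (v ⊕ e₁) → ⊥
    not-adjacent (a , b , refl , s) (a′ , b′ , e , s′)
      with pt-injective (trans (sym (pt-⊕e₁ a b)) e)
    ... | refl , refl = seeds-not-adjacent s s′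

row₂-point row₄-point : ℕ → ℤ²
row₂-point i = pt (2 * i) 2
row₄-point j = pt (suc (2 * j)) 4

row₀-seeds : Subset
row₀-seeds = (｛ pt 0 0 ｝ ∪ ｛ pt 3 0 ｝) ∪ ｛ pt 5 0 ｝

seed-pieces : ℕ → Subset
seed-pieces m = row₀-seeds ∪ (Image row₂-point (2 + m) ∪ Image row₄-point (1 + m))

seeds⇔seed-pieces : ∀ m v → seeds m v ⇔ seed-pieces m v
seeds⇔seed-pieces m v = mk⇔ split join
  where
    split : seeds m v → seed-pieces m v
    split (_ , _ , refl , seed₀)            = inj₁ (inj₁ (inj₁ refl))
    split (_ , _ , refl , seed₃)            = inj₁ (inj₁ (inj₂ refl))
    split (_ , _ , refl , seed₅)            = inj₁ (inj₂ refl)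
    split (_ , _ , refl , even₂ i i< refl)  = inj₂ (inj₁ (i , i< , refl))
    split (_ , _ , refl , odd₄ j j< refl)   = inj₂ (inj₂ (j , j< , refl))
    join : seed-pieces m v → seeds m v
    join (inj₁ (inj₁ (inj₁ refl)))     = _ , _ , refl , seed₀
    join (inj₁ (inj₁ (inj₂ refl)))     = _ , _ , refl , seed₃
    join (inj₁ (inj₂ refl))            = _ , _ , refl , seed₅
    join (inj₂ (inj₁ (i , i< , refl))) = _ , _ , refl , even₂ i i< refl
    join (inj₂ (inj₂ (j , j< , refl))) = _ , _ , refl , odd₄ j j< refl

HasCard-seed-pieces : ∀ m → HasCard (seed-pieces m) (((1 + 1) + 1) + ((2 + m) + (1 + m)))
HasCard-seed-pieces m =
  HasCard-∪
    (HasCard-∪ (HasCard-∪ (HasCard-singleton (pt 0 0)) (HasCard-singleton (pt 3 0)) λ { refl () })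
               (HasCard-singleton (pt 5 0)) λ { (inj₁ refl) () ; (inj₂ refl) () })
    (HasCard-∪ (HasCard-image row₂-point row₂-injective (2 + m)) (HasCard-image row₄-point row₄-injective (1 + m))
               λ { (_ , _ , refl) (_ , _ , ()) })
    row₀-apart
  where
    row₂-injective : ∀ {i j} → row₂-point i ≡ row₂-point j → i ≡ j
    row₂-injective e = *-cancelˡ-≡ _ _ 2 (proj₁ (pt-injective e))
    row₄-injective : ∀ {i j} → row₄-point i ≡ row₄-point j → i ≡ j
    row₄-injective e = *-cancelˡ-≡ _ _ 2 (suc-injective (proj₁ (pt-injective e)))
    row₀-apart : ∀ {v} → row₀-seeds v → (Image row₂-point (2 + m) ∪ Image row₄-point (1 + m)) v → ⊥
    row₀-apart (inj₁ (inj₁ refl)) (inj₁ (_ , _ , ()))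
    row₀-apart (inj₁ (inj₁ refl)) (inj₂ (_ , _ , ()))
    row₀-apart (inj₁ (inj₂ refl)) (inj₁ (_ , _ , ()))
    row₀-apart (inj₁ (inj₂ refl)) (inj₂ (_ , _ , ()))
    row₀-apart (inj₂ refl)        (inj₁ (_ , _ , ()))
    row₀-apart (inj₂ refl)        (inj₂ (_ , _ , ()))

HasCard-φ-seeds : ∀ m → HasCard (φ (seeds m)) (2 * (3 + m))
HasCard-φ-seeds m = subst (HasCard (φ (seeds m))) (count m)
  (HasCard-⇔ (λ v → mk⇔ (base ∘ from (seeds⇔seed-pieces m v)) (to (seeds⇔seed-pieces m v) ∘ φ-seeds m v))
             (HasCard-seed-pieces m))
  where
    count : ∀ m → ((1 + 1) + 1) + ((2 + m) + (1 + m)) ≡ 2 * (3 + m)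
    count = solve-∀

proposition8 : (M : ℕ) → Σ ℕ λ n → Σ Subset λ P →
    (P ⊆ T n) × ψ≡ P (T n) ×
    (Σ ℕ λ t → Σ ℕ λ f → HasCard (T n) t × HasCard (φ P) f × (M + f ≤ t))
proposition8 M =
  n , seeds M , seeds⊆T M , (spans , maximal) ,
  triangular n , n , HasCard-T n , HasCard-φ-seeds M , bound
  where
    n : ℕ
    n = 2 * (3 + M)
    spans : Spanning (seeds M) (T n)
    spans = forces⇒spanning (forces-trans (seeds-force-bottom-row M) (bottom-row-forces-T n))
    maximal : ∀ D → Spanning (seeds M) D → D ⊆ T n
    maximal D = spanning⇒⊆ (T-or-separated n) (seeds⊆T M)
    bound : M + n ≤ triangular n
    bound = m<n⇒m+n≤triangular (≤-trans (m≤n+m (suc M) 2) (m≤m+n (3 + M) _))
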